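{- For every positive integer $n$, $h_2(2n)\le 2h_2(n)$.
   Context: For $n\in\mathbb{N}$, let $\sigma:\mathbb{F}_2^n\to\mathbb{F}_2^n$ be the cyclic shift $\sigma(\sum_{i=0}^{n-1}x_ie_i)=\sum_{i=0}^{n-1}x_ie_{i+1}$ (indices mod $n$). A subspace $U\le\mathbb{F}_2^n$ is cyclically covering if $\bigcup_{i=0}^{n-1}\sigma^i(U)=\mathbb{F}_2^n$. $h_2(n)$ denotes the largest possible codimension of a cyclically covering subspace of $\mathbb{F}_2^n$. -}

module Defs where

open import Data.Bool using (Bool; false; true; _xor_)
open import Data.Nat using (ℕ; zero; suc; _+_)
open import Data.Fin using (Fin; toℕ)
open import Data.Vec using (Vec; []; _∷_; zipWith; replicate; init; last; foldr; lookup; tabulate)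
open import Data.Product using (Σ; ∃; _×_; _,_)
open import Relation.Binary.PropositionalEquality using (_≡_)
open import Level using (Level; 0ℓ) renaming (suc to lsuc)

-- Vectors of 𝔽₂ⁿ, with 𝔽₂ = Bool (false = 0, true = 1, xor = addition).
𝔽₂^ : ℕ → Set
𝔽₂^ n = Vec Bool n

0v : ∀ {n} → 𝔽₂^ n
0v {n} = replicate n false

infixl 6 _⊕_
_⊕_ : ∀ {n} → 𝔽₂^ n → 𝔽₂^ n → 𝔽₂^ n
_⊕_ = zipWith _xor_

_·_ : ∀ {n} → Bool → 𝔽₂^ n → 𝔽₂^ n
false · v = 0v
true  · v = v

-- Cyclic shift σ(Σ xᵢ eᵢ) = Σ xᵢ e_{i+1}: σ(x)₀ = x_{n-1}, σ(x)_{j} = x_{j-1}.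
σ : ∀ {n} → 𝔽₂^ n → 𝔽₂^ n
σ []       = []
σ (x ∷ xs) = last (x ∷ xs) ∷ init (x ∷ xs)

σ^ : ∀ {n} → ℕ → 𝔽₂^ n → 𝔽₂^ n
σ^ zero    v = v
σ^ (suc i) v = σ (σ^ i v)

-- A linear subspace of 𝔽₂ⁿ (over 𝔽₂ closure under + suffices, scalars being 0,1).
record Subspace (n : ℕ) : Set₁ where
  field
    _∈U    : 𝔽₂^ n → Set
    0∈U    : 0v ∈U
    ⊕-closed : ∀ {u v} → u ∈U → v ∈U → (u ⊕ v) ∈U
open Subspace public

lincomb : ∀ {n d} → Vec Bool d → Vec (𝔽₂^ n) d → 𝔽₂^ n
lincomb []       []       = 0v
lincomb (c ∷ cs) (b ∷ bs) = (c · b) ⊕ lincomb cs bs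

IsBasis : ∀ {n d} → Subspace n → Vec (𝔽₂^ n) d → Set
IsBasis {n} {d} U b =
    (∀ (i : Fin d) → _∈U U (lookup b i))
  × (∀ (c : Vec Bool d) → lincomb c b ≡ 0v → c ≡ replicate d false)
  × (∀ (u : 𝔽₂^ n) → _∈U U u → ∃ λ (c : Vec Bool d) → lincomb c b ≡ u)

HasDim : ∀ {n} → Subspace n → ℕ → Set
HasDim U d = Σ (Vec _ d) (IsBasis U)

HasCodim : ∀ {n} → Subspace n → ℕ → Set
HasCodim {n} U k = ∃ λ d → HasDim U d × (d + k ≡ n)

CyclicallyCovering : ∀ {n} → Subspace n → Set
CyclicallyCovering {n} U =
  ∀ (v : 𝔽₂^ n) → ∃ λ (i : Fin n) → ∃ λ (u : 𝔽₂^ n) → _∈U U u × (v ≡ σ^ (toℕ i) u)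

module Submission where

-- Let U ≤ 𝔽₂²ⁿ be cyclically covering of codimension k.  Writing vectors of
-- 𝔽₂²ⁿ as pairs xy of halves, consider the doubling map double x = xx and the folding map
-- fold xy = x ⊕ y.  Both are linear and commute with the cyclic shift, fold ∘ double = 0, and
-- y ↦ y0 is a section of fold.  Hence the lower half double⁻¹(U) and the upper half fold(U) are
-- cyclically covering subspaces of 𝔽₂ⁿ, and since double embeds the lower half into U ∩ ker fold,
-- dim lower + dim upper ≤ dim U, i.e. codim lower + codim upper ≥ k.  One of the two halves
-- therefore has codimension at least k/2.

open import Defs
open import Data.Nat using (ℕ; suc; _*_; _≤_)
open import Data.Product using (∃; _×_)

open import Algebra.Definitions using (Associative)
open import Data.Bool using (Bool; true; false; _xor_)
import Data.Bool.Properties as BP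
open import Data.Empty using (⊥-elim)
open import Data.Fin as Fin using (Fin; toℕ; fromℕ<; combine; remQuot)
import Data.Fin.Properties as FP
import Data.List as List
open import Data.List using (List)
import Data.List.Properties as LP
open import Data.List.Membership.Propositional using () renaming (_∈_ to _∈ˡ_)
open import Data.List.Membership.Propositional.Properties using (∈-map⁺; ∈-allFin)
open import Data.List.Relation.Unary.Any using (here; there)
open import Data.Nat using (zero; _+_; _∸_; _^_; _%_; _/_; NonZero; z≤n; s≤s)
open import Data.Nat.Divisibility using (_∣_; divides)
open import Data.Nat.DivMod using (m≡m%n+[m/n]*n; m%n<n)
import Data.Nat.Properties as NP
open import Algebra.Properties.CommutativeSemigroup NP.+-commutativeSemigroup using () renaming (interchange to +-interchange)
open import Data.Product using (_,_; proj₁; proj₂)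
open import Data.Sum using (_⊎_; inj₁; inj₂; [_,_]′)
open import Data.Vec using (Vec; []; _∷_; _++_; replicate; lookup; tabulate; map; take; drop; init; last; _∷ʳ_; initLast; toList)
import Data.Vec as Vec
import Data.Vec.Properties as VP
open import Data.Vec.Relation.Binary.Equality.Cast using (cast-is-id)
open import Function using (_∘_; Injective)
open import Relation.Binary.PropositionalEquality
open import Relation.Nullary using (Dec; yes; no; ¬_)
open import Relation.Nullary.Decidable using (map′; _⊎-dec_; _×-dec_)

infix 4 _∈_
_∈_ : ∀ {n} → 𝔽₂^ n → Subspace n → Set
v ∈ W = _∈U W v

⊕-assoc : ∀ {n} → Associative _≡_ (_⊕_ {n})
⊕-assoc = VP.zipWith-assoc BP.xor-assoc

⊕-comm : ∀ {n} (x y : 𝔽₂^ n) → x ⊕ y ≡ y ⊕ x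
⊕-comm = VP.zipWith-comm BP.xor-comm

⊕-identityˡ : ∀ {n} (x : 𝔽₂^ n) → 0v ⊕ x ≡ x
⊕-identityˡ = VP.zipWith-identityˡ BP.xor-identityˡ

⊕-identityʳ : ∀ {n} (x : 𝔽₂^ n) → x ⊕ 0v ≡ x
⊕-identityʳ = VP.zipWith-identityʳ BP.xor-identityʳ

⊕-self : ∀ {n} (x : 𝔽₂^ n) → x ⊕ x ≡ 0v
⊕-self []      = refl
⊕-self (a ∷ x) = cong₂ _∷_ (BP.xor-same a) (⊕-self x)

⊕-interchange : ∀ {n} (p q r s : 𝔽₂^ n) → (p ⊕ q) ⊕ (r ⊕ s) ≡ (p ⊕ r) ⊕ (q ⊕ s)
⊕-interchange p q r s = begin
  (p ⊕ q) ⊕ (r ⊕ s) ≡⟨ ⊕-assoc p q (r ⊕ s) ⟩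
  p ⊕ (q ⊕ (r ⊕ s)) ≡⟨ cong (p ⊕_) (sym (⊕-assoc q r s)) ⟩
  p ⊕ ((q ⊕ r) ⊕ s) ≡⟨ cong (λ t → p ⊕ (t ⊕ s)) (⊕-comm q r) ⟩
  p ⊕ ((r ⊕ q) ⊕ s) ≡⟨ cong (p ⊕_) (⊕-assoc r q s) ⟩
  p ⊕ (r ⊕ (q ⊕ s)) ≡⟨ sym (⊕-assoc p r (q ⊕ s)) ⟩
  (p ⊕ r) ⊕ (q ⊕ s) ∎
  where open ≡-Reasoning

⊕-cancel : ∀ {n} (x y : 𝔽₂^ n) → x ⊕ y ≡ 0v → x ≡ y
⊕-cancel x y x⊕y≡0 = begin
  x             ≡⟨ sym (⊕-identityʳ x) ⟩
  x ⊕ 0v        ≡⟨ cong (x ⊕_) (sym (⊕-self y)) ⟩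
  x ⊕ (y ⊕ y)   ≡⟨ sym (⊕-assoc x y y) ⟩
  (x ⊕ y) ⊕ y   ≡⟨ cong (_⊕ y) x⊕y≡0 ⟩
  0v ⊕ y        ≡⟨ ⊕-identityˡ y ⟩
  y             ∎
  where open ≡-Reasoning

·-distrib : ∀ {n} a b (v : 𝔽₂^ n) → (a xor b) · v ≡ (a · v) ⊕ (b · v)
·-distrib false false v = sym (⊕-self 0v)
·-distrib false true  v = sym (⊕-identityˡ v)
·-distrib true  false v = sym (⊕-identityʳ v)
·-distrib true  true  v = sym (⊕-self v)

lincomb-zero : ∀ {n d} (a : Vec (𝔽₂^ n) d) → lincomb (replicate d false) a ≡ 0v
lincomb-zero []      = refl
lincomb-zero (b ∷ a) = trans (⊕-identityˡ _) (lincomb-zero a)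

lincomb-⊕ : ∀ {n d} (c c′ : Vec Bool d) (a : Vec (𝔽₂^ n) d) →
            lincomb (c ⊕ c′) a ≡ lincomb c a ⊕ lincomb c′ a
lincomb-⊕ []      []        []      = sym (⊕-self 0v)
lincomb-⊕ (x ∷ c) (y ∷ c′) (b ∷ a) =
  trans (cong₂ _⊕_ (·-distrib x y b) (lincomb-⊕ c c′ a))
        (⊕-interchange (x · b) (y · b) (lincomb c a) (lincomb c′ a))

lincomb-++ : ∀ {n d e} (α : Vec Bool d) (β : Vec Bool e) (A : Vec (𝔽₂^ n) d) (B : Vec (𝔽₂^ n) e) →
             lincomb (α ++ β) (A ++ B) ≡ lincomb α A ⊕ lincomb β B
lincomb-++ []      β []      B = sym (⊕-identityˡ _)
lincomb-++ (x ∷ α) β (b ∷ A) B =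
  trans (cong ((x · b) ⊕_) (lincomb-++ α β A B)) (sym (⊕-assoc (x · b) _ _))

-- Linear maps (additivity suffices over 𝔽₂) commute with linear combinations.

IsLinear : ∀ {m p} → (𝔽₂^ m → 𝔽₂^ p) → Set
IsLinear f = ∀ x y → f (x ⊕ y) ≡ f x ⊕ f y

linear-0 : ∀ {m p} {f : 𝔽₂^ m → 𝔽₂^ p} → IsLinear f → f 0v ≡ 0v
linear-0 {f = f} lin = begin
  f 0v           ≡⟨ cong f (sym (⊕-self 0v)) ⟩
  f (0v ⊕ 0v)    ≡⟨ lin 0v 0v ⟩
  f 0v ⊕ f 0v    ≡⟨ ⊕-self (f 0v) ⟩
  0v             ∎
  where open ≡-Reasoning

linear-lincomb : ∀ {m p d} {f : 𝔽₂^ m → 𝔽₂^ p} → IsLinear f →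
                 (u : Vec (𝔽₂^ m) d) (a : Vec (𝔽₂^ p) d) → (∀ i → f (lookup u i) ≡ lookup a i) →
                 ∀ c → f (lincomb c u) ≡ lincomb c a
linear-lincomb lin []       []       fu≡a []      = linear-0 lin
linear-lincomb {f = f} lin (u₀ ∷ u) (a₀ ∷ a) fu≡a (x ∷ c) =
  trans (lin (x · u₀) (lincomb c u))
        (cong₂ _⊕_ (scale x) (linear-lincomb lin u a (fu≡a ∘ Fin.suc) c))
  where
  scale : ∀ x → f (x · u₀) ≡ x · a₀
  scale false = linear-0 lin
  scale true  = fu≡a Fin.zero

lincomb-closed : ∀ {n d} (W : Subspace n) (a : Vec (𝔽₂^ n) d) →
                 (∀ i → lookup a i ∈ W) → ∀ c → lincomb c a ∈ W
lincomb-closed W []       a∈W []      = 0∈U W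
lincomb-closed W (a₀ ∷ a) a∈W (x ∷ c) =
  ⊕-closed W (scale x) (lincomb-closed W a (a∈W ∘ Fin.suc) c)
  where
  scale : ∀ x → (x · a₀) ∈ W
  scale false = 0∈U W
  scale true  = a∈W Fin.zero

kernel : ∀ {m p} (f : 𝔽₂^ m → 𝔽₂^ p) → IsLinear f → Subspace m
kernel f lin = record
  { _∈U      = λ u → f u ≡ 0v
  ; 0∈U      = linear-0 lin
  ; ⊕-closed = λ {u} {v} fu≡0 fv≡0 → trans (lin u v) (trans (cong₂ _⊕_ fu≡0 fv≡0) (⊕-self 0v))
  }

preimage : ∀ {m p} (f : 𝔽₂^ m → 𝔽₂^ p) → IsLinear f → Subspace p → Subspace m
preimage f lin W = record
  { _∈U      = λ u → f u ∈ W
  ; 0∈U      = subst (_∈ W) (sym (linear-0 lin)) (0∈U W)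
  ; ⊕-closed = λ {u} {v} fu∈W fv∈W → subst (_∈ W) (sym (lin u v)) (⊕-closed W fu∈W fv∈W)
  }

image : ∀ {m p} (f : 𝔽₂^ m → 𝔽₂^ p) → IsLinear f → Subspace m → Subspace p
image f lin W = record
  { _∈U      = λ v → ∃ λ u → u ∈ W × f u ≡ v
  ; 0∈U      = 0v , 0∈U W , linear-0 lin
  ; ⊕-closed = λ { (u , u∈W , refl) (u′ , u′∈W , refl) →
                   u ⊕ u′ , ⊕-closed W u∈W u′∈W , lin u u′ }
  }

Span : ∀ {n d} → Vec (𝔽₂^ n) d → 𝔽₂^ n → Set
Span a u = ∃ λ c → lincomb c a ≡ u

Independent : ∀ {n d} → Vec (𝔽₂^ n) d → Set
Independent {d = d} a = ∀ c → lincomb c a ≡ 0v → c ≡ replicate d false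

lincomb-injective : ∀ {n d} {a : Vec (𝔽₂^ n) d} → Independent a →
                    ∀ x y → lincomb x a ≡ lincomb y a → x ≡ y
lincomb-injective {a = a} independent x y same = ⊕-cancel x y (independent (x ⊕ y) (begin
  lincomb (x ⊕ y) a             ≡⟨ lincomb-⊕ x y a ⟩
  lincomb x a ⊕ lincomb y a     ≡⟨ cong (_⊕ lincomb y a) same ⟩
  lincomb y a ⊕ lincomb y a     ≡⟨ ⊕-self (lincomb y a) ⟩
  0v                            ∎))
  where open ≡-Reasoning

any? : ∀ {s} {P : 𝔽₂^ s → Set} → (∀ c → Dec (P c)) → Dec (∃ P)
any? {zero}  P? = map′ ([] ,_) (λ { ([] , p) → p }) (P? [])
any? {suc s} P? = map′ (λ { (inj₁ (c , p)) → false ∷ c , p ; (inj₂ (c , p)) → true ∷ c , p })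
                       (λ { (false ∷ c , p) → inj₁ (c , p) ; (true ∷ c , p) → inj₂ (c , p) })
                       (any? (P? ∘ (false ∷_)) ⊎-dec any? (P? ∘ (true ∷_)))

_≟_ : ∀ {n} (x y : 𝔽₂^ n) → Dec (x ≡ y)
_≟_ = VP.≡-dec BP._≟_

span? : ∀ {n d} (a : Vec (𝔽₂^ n) d) u → Dec (Span a u)
span? a u = any? (λ c → lincomb c a ≟ u)

basis-decidable : ∀ {n d} {W : Subspace n} {b : Vec (𝔽₂^ n) d} → IsBasis W b → ∀ u → Dec (u ∈ W)
basis-decidable {W = W} {b} (b∈W , _ , spans) u =
  map′ (λ { (c , refl) → lincomb-closed W b b∈W c }) (spans u) (span? b u)

image-decidable : ∀ {m p} (f : 𝔽₂^ m → 𝔽₂^ p) (lin : IsLinear f) {W : Subspace m} →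
                  (∀ u → Dec (u ∈ W)) → ∀ v → Dec (v ∈ image f lin W)
image-decidable f lin W? v = any? (λ u → W? u ×-dec (f u ≟ v))

-- 𝔽₂ˢ is in bijection with Fin 2ˢ (binary expansion); this lets us count vectors.

bit : Bool → Fin 2
bit false = Fin.zero
bit true  = Fin.suc Fin.zero

bool : Fin 2 → Bool
bool Fin.zero           = false
bool (Fin.suc Fin.zero) = true

encode : ∀ {s} → 𝔽₂^ s → Fin (2 ^ s)
encode []      = Fin.zero
encode (x ∷ v) = combine (bit x) (encode v)

decode : ∀ s → Fin (2 ^ s) → 𝔽₂^ s
decode zero    _ = []
decode (suc s) i = let (q , r) = remQuot (2 ^ s) i in bool q ∷ decode s r

encode-decode : ∀ s (i : Fin (2 ^ s)) → encode (decode s i) ≡ i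
encode-decode zero Fin.zero = refl
encode-decode (suc s) i = begin
  combine (bit (bool (proj₁ qr))) (encode (decode s (proj₂ qr)))
    ≡⟨ cong₂ combine (bit-bool (proj₁ qr)) (encode-decode s (proj₂ qr)) ⟩
  combine (proj₁ qr) (proj₂ qr)
    ≡⟨ FP.combine-remQuot (2 ^ s) i ⟩
  i ∎
  where
  open ≡-Reasoning
  qr = remQuot {2} (2 ^ s) i
  bit-bool : ∀ q → bit (bool q) ≡ q
  bit-bool Fin.zero           = refl
  bit-bool (Fin.suc Fin.zero) = refl

decode-encode : ∀ {s} (v : 𝔽₂^ s) → decode s (encode v) ≡ v
decode-encode []      = refl
decode-encode (x ∷ v) = begin
  decode _ (combine (bit x) (encode v))
    ≡⟨ cong (λ qr → bool (proj₁ qr) ∷ decode _ (proj₂ qr)) (FP.remQuot-combine (bit x) (encode v)) ⟩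
  bool (bit x) ∷ decode _ (encode v)
    ≡⟨ cong₂ _∷_ (bool-bit x) (decode-encode v) ⟩
  x ∷ v ∎
  where
  open ≡-Reasoning
  bool-bit : ∀ x → bool (bit x) ≡ x
  bool-bit false = refl
  bool-bit true  = refl

injection⇒≤ : ∀ {e d} (f : 𝔽₂^ e → 𝔽₂^ d) → (∀ x y → f x ≡ f y → x ≡ y) → e ≤ d
injection⇒≤ {e} {d} f f-injective with e NP.≤? d
... | yes e≤d = e≤d
... | no  e≰d = ⊥-elim (NP.<⇒≱ (NP.^-monoʳ-< 2 (s≤s (s≤s z≤n)) (NP.≰⇒> e≰d)) 2^e≤2^d)
  where
  g : Fin (2 ^ e) → Fin (2 ^ d)
  g = encode ∘ f ∘ decode e
  g-injective : Injective _≡_ _≡_ g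
  g-injective {i} {j} gi≡gj = begin
    i                     ≡⟨ sym (encode-decode e i) ⟩
    encode (decode e i)   ≡⟨ cong encode (f-injective _ _ (begin
      f (decode e i)      ≡⟨ sym (decode-encode _) ⟩
      decode d (g i)      ≡⟨ cong (decode d) gi≡gj ⟩
      decode d (g j)      ≡⟨ decode-encode _ ⟩
      f (decode e j)      ∎)) ⟩
    encode (decode e j)   ≡⟨ encode-decode e j ⟩
    j                   ∎
    where open ≡-Reasoning
  2^e≤2^d : 2 ^ e ≤ 2 ^ d
  2^e≤2^d = FP.injective⇒≤ g-injective

vectors : ∀ n → List (𝔽₂^ n)
vectors n = List.map (decode n) (List.allFin (2 ^ n))

vectors-complete : ∀ {n} (v : 𝔽₂^ n) → v ∈ˡ vectors n
vectors-complete {n} v = subst (_∈ˡ vectors n) (decode-encode v) (∈-map⁺ (decode n) (∈-allFin (encode v)))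

independent≤ambient : ∀ {m e} (a : Vec (𝔽₂^ m) e) → Independent a → e ≤ m
independent≤ambient a independent = injection⇒≤ (λ c → lincomb c a) (lincomb-injective independent)

independent≤dim : ∀ {m e d} {W : Subspace m} {b : Vec (𝔽₂^ m) d} → IsBasis W b →
                  (a : Vec (𝔽₂^ m) e) → Independent a → (∀ x → lincomb x a ∈ W) → e ≤ d
independent≤dim {e = e} {d} {b = b} (_ , b-independent , b-spans) a a-independent a∈W =
  injection⇒≤ coordinates (λ x y same → lincomb-injective a-independent x y (begin
    lincomb x a                  ≡⟨ sym (proj₂ (b-spans _ (a∈W x))) ⟩
    lincomb (coordinates x) b    ≡⟨ cong (λ c → lincomb c b) same ⟩
    lincomb (coordinates y) b    ≡⟨ proj₂ (b-spans _ (a∈W y)) ⟩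
    lincomb y a                  ∎))
  where
  open ≡-Reasoning
  coordinates : Vec Bool e → Vec Bool d
  coordinates x = proj₁ (b-spans (lincomb x a) (a∈W x))

span-∷ : ∀ {n s g u} {a : Vec (𝔽₂^ n) s} → Span a u → Span (g ∷ a) u
span-∷ (c , refl) = false ∷ c , ⊕-identityˡ _

span-head : ∀ {n s g} (a : Vec (𝔽₂^ n) s) → Span (g ∷ a) g
span-head {g = g} a = true ∷ replicate _ false , trans (cong (g ⊕_) (lincomb-zero a)) (⊕-identityʳ g)

independent-∷ : ∀ {n s g} {a : Vec (𝔽₂^ n) s} → Independent a → ¬ Span a g → Independent (g ∷ a)
independent-∷ a-indep g∉span (false ∷ c) c≡0 = cong (false ∷_) (a-indep c (trans (sym (⊕-identityˡ _)) c≡0))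
independent-∷ a-indep g∉span (true  ∷ c) c≡0 = ⊥-elim (g∉span (c , sym (⊕-cancel _ _ c≡0)))

-- Every decidable subspace has a basis: scan all vectors of 𝔽₂ⁿ, adding each member of W that
-- is not yet spanned.  The family stays independent and eventually spans all of W.
module BasisExtension {n} (W : Subspace n) (W? : ∀ v → Dec (v ∈ W)) where

  AllIn : ∀ {s} → Vec (𝔽₂^ n) s → Set
  AllIn a = ∀ i → lookup a i ∈ W

  record Extension (L : List (𝔽₂^ n)) {s} (a : Vec (𝔽₂^ n) s) : Set where
    field
      {size}      : ℕ
      family      : Vec (𝔽₂^ n) size
      independent : Independent family
      inside      : AllIn family
      extends     : ∀ {u} → Span a u → Span family u
      absorbs     : ∀ {g} → g ∈ˡ L → g ∈ W → Span family g

  open Extension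

  absorb : ∀ {L s s′ g} {a : Vec (𝔽₂^ n) s} {a′ : Vec (𝔽₂^ n) s′} (E : Extension L a′) →
           (∀ {u} → Span a u → Span a′ u) → (g ∈ W → Span (family E) g) → Extension (g List.∷ L) a
  absorb E a⊆a′ g-spanned = record
    { family = family E ; independent = independent E ; inside = inside E ; extends = extends E ∘ a⊆a′
    ; absorbs = λ { (here refl) → g-spanned ; (there g∈L) → absorbs E g∈L } }

  extend : ∀ L {s} (a : Vec (𝔽₂^ n) s) → Independent a → AllIn a → Extension L a
  extend List.[]      a a-indep a∈W = record
    { family = a ; independent = a-indep ; inside = a∈W ; extends = λ p → p ; absorbs = λ () }
  extend (g List.∷ L) a a-indep a∈W with W? g | span? a g
  ... | no g∉W  | _          = absorb (extend L a a-indep a∈W) (λ p → p) (λ g∈W → ⊥-elim (g∉W g∈W))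
  ... | yes _   | yes g∈span = let E = extend L a a-indep a∈W in absorb E (λ p → p) (λ _ → extends E g∈span)
  ... | yes g∈W | no g∉span  =
    let E = extend L (g ∷ a) (independent-∷ a-indep g∉span) λ { Fin.zero → g∈W ; (Fin.suc i) → a∈W i }
    in absorb E span-∷ (λ _ → extends E (span-head a))

  basis : ∃ λ d → HasDim W d
  basis = let E = extend (vectors n) [] (λ { [] _ → refl }) (λ ()) in
    size E , family E , inside E , independent E , λ u u∈W → absorbs E (vectors-complete u) u∈W

replicate-++ : ∀ {A : Set} d₁ d₂ (x : A) → replicate d₁ x ++ replicate d₂ x ≡ replicate (d₁ + d₂) x
replicate-++ zero     d₂ x = refl
replicate-++ (suc d₁) d₂ x = cong (x ∷_) (replicate-++ d₁ d₂ x)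

-- Then c ++ ℓ is independent: applying f to a relation kills the
-- c-part and leaves a relation among the aᵢ.
independent-++ : ∀ {m p d₁ d₂} {f : 𝔽₂^ m → 𝔽₂^ p} (lin : IsLinear f)
                 (c : Vec (𝔽₂^ m) d₁) → Independent c → (∀ i → f (lookup c i) ≡ 0v) →
                 (ℓ : Vec (𝔽₂^ m) d₂) (a : Vec (𝔽₂^ p) d₂) → Independent a → (∀ i → f (lookup ℓ i) ≡ lookup a i) →
                 Independent (c ++ ℓ)
independent-++ {d₁ = d₁} {d₂} {f} lin c c-indep fc≡0 ℓ a a-indep fℓ≡a x relation
  with Vec.splitAt d₁ x
... | α , β , refl = begin
  α ++ β                                      ≡⟨ cong₂ _++_ α≡0 β≡0 ⟩
  replicate d₁ false ++ replicate d₂ false    ≡⟨ replicate-++ d₁ d₂ false ⟩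
  replicate (d₁ + d₂) false                   ∎
  where
  open ≡-Reasoning
  split : lincomb α c ⊕ lincomb β ℓ ≡ 0v
  split = trans (sym (lincomb-++ α β c ℓ)) relation
  fα≡0 : f (lincomb α c) ≡ 0v
  fα≡0 = lincomb-closed (kernel f lin) c fc≡0 α
  β≡0 : β ≡ replicate d₂ false
  β≡0 = a-indep β (begin
    lincomb β a                          ≡⟨ sym (linear-lincomb lin ℓ a fℓ≡a β) ⟩
    f (lincomb β ℓ)                      ≡⟨ sym (⊕-identityˡ _) ⟩
    0v ⊕ f (lincomb β ℓ)                 ≡⟨ cong (_⊕ f (lincomb β ℓ)) (sym fα≡0) ⟩
    f (lincomb α c) ⊕ f (lincomb β ℓ)    ≡⟨ sym (lin _ _) ⟩
    f (lincomb α c ⊕ lincomb β ℓ)        ≡⟨ cong f split ⟩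
    f 0v                                 ≡⟨ linear-0 lin ⟩
    0v                                   ∎)
  α≡0 : α ≡ replicate d₁ false
  α≡0 = c-indep α (begin
    lincomb α c                          ≡⟨ sym (⊕-identityʳ _) ⟩
    lincomb α c ⊕ 0v                     ≡⟨ cong (lincomb α c ⊕_) (sym (trans (cong (λ t → lincomb t ℓ) β≡0) (lincomb-zero ℓ))) ⟩
    lincomb α c ⊕ lincomb β ℓ            ≡⟨ split ⟩
    0v                                   ∎)

-- Half of rank–nullity: if W has a basis of size d and f is linear, an independent family in
-- W ∩ ker f and an independent family in f(W) have at most d members together.
kernel+image≤dim : ∀ {m p d d₁ d₂} {f : 𝔽₂^ m → 𝔽₂^ p} (lin : IsLinear f) {W : Subspace m}
                   {b : Vec (𝔽₂^ m) d} → IsBasis W b →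
                   (c : Vec (𝔽₂^ m) d₁) → Independent c → (∀ i → lookup c i ∈ W) → (∀ i → f (lookup c i) ≡ 0v) →
                   (a : Vec (𝔽₂^ p) d₂) → Independent a → (∀ i → lookup a i ∈ image f lin W) →
                   d₁ + d₂ ≤ d
kernel+image≤dim {d₁ = d₁} {f = f} lin {W} basis c c-indep c∈W fc≡0 a a-indep a∈fW =
  independent≤dim {W = W} basis (c ++ ℓ) (independent-++ lin c c-indep fc≡0 ℓ a a-indep fℓ≡a) combination∈W
  where
  ℓ = tabulate (λ i → proj₁ (a∈fW i))
  ℓ∈W : ∀ i → lookup ℓ i ∈ W
  ℓ∈W i = subst (_∈ W) (sym (VP.lookup∘tabulate _ i)) (proj₁ (proj₂ (a∈fW i)))
  fℓ≡a : ∀ i → f (lookup ℓ i) ≡ lookup a i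
  fℓ≡a i = trans (cong f (VP.lookup∘tabulate _ i)) (proj₂ (proj₂ (a∈fW i)))
  combination∈W : ∀ x → lincomb x (c ++ ℓ) ∈ W
  combination∈W x with Vec.splitAt d₁ x
  ... | α , β , refl = subst (_∈ W) (sym (lincomb-++ α β c ℓ))
                             (⊕-closed W (lincomb-closed W c c∈W α) (lincomb-closed W ℓ ℓ∈W β))

σ-∷ʳ : ∀ {N} (xs : 𝔽₂^ N) z → σ (xs ∷ʳ z) ≡ z ∷ xs
σ-∷ʳ []       z = refl
σ-∷ʳ (x ∷ xs) z = cong₂ _∷_ (VP.last-∷ʳ z (x ∷ xs)) (VP.init-∷ʳ z (x ∷ xs))

σ-toList : ∀ {N} (v : 𝔽₂^ N) l y → toList v ≡ l List.++ List.[ y ] → toList (σ v) ≡ y List.∷ l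
σ-toList {zero}  [] List.[]       y ()
σ-toList {zero}  [] (_ List.∷ _) y ()
σ-toList {suc N} v  l             y v≡l∷ʳy with initLast v
... | xs , z , refl with LP.∷ʳ-injective (toList xs) l (trans (sym (VP.toList-∷ʳ z xs)) v≡l∷ʳy)
...   | xs≡l , z≡y = trans (cong toList (σ-∷ʳ xs z)) (cong₂ List._∷_ z≡y xs≡l)

-- σᵏ moves the last k coordinates to the front (stated on lists to avoid length casts).
σ^-rotate : ∀ {N k} (v : 𝔽₂^ N) l (ys : 𝔽₂^ k) →
            toList v ≡ l List.++ toList ys → toList (σ^ k v) ≡ toList ys List.++ l
σ^-rotate v l []       v≡l++ys = trans v≡l++ys (LP.++-identityʳ l)
σ^-rotate {k = suc k} v l (y ∷ ys) v≡l++ys =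
  σ-toList (σ^ k v) (toList ys List.++ l) y (begin
    toList (σ^ k v)                             ≡⟨ σ^-rotate v (l List.++ List.[ y ]) ys
                                                     (trans v≡l++ys (sym (LP.++-assoc l List.[ y ] (toList ys)))) ⟩
    toList ys List.++ (l List.++ List.[ y ])    ≡⟨ sym (LP.++-assoc (toList ys) l List.[ y ]) ⟩
    (toList ys List.++ l) List.++ List.[ y ]    ∎)
  where open ≡-Reasoning

σ^-period : ∀ {N} (v : 𝔽₂^ N) → σ^ N v ≡ v
σ^-period {N} v = trans (sym (cast-is-id refl (σ^ N v)))
  (VP.toList-injective refl _ _ (trans (σ^-rotate v List.[] v refl) (LP.++-identityʳ (toList v))))

σ^-+ : ∀ {N} a b (v : 𝔽₂^ N) → σ^ (a + b) v ≡ σ^ a (σ^ b v)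
σ^-+ zero    b v = refl
σ^-+ (suc a) b v = cong σ (σ^-+ a b v)

σ^-multiple : ∀ {n m} → n ∣ m → (v : 𝔽₂^ n) → σ^ m v ≡ v
σ^-multiple {n} (divides q refl) v = go q
  where
  go : ∀ q → σ^ (q * n) v ≡ v
  go zero    = refl
  go (suc q) = trans (σ^-+ n (q * n) v) (trans (cong (σ^ n) (go q)) (σ^-period v))

σ^-reduce : ∀ {N} .{{_ : NonZero N}} i (v : 𝔽₂^ N) → ∃ λ (r : Fin N) → σ^ i v ≡ σ^ (toℕ r) v
σ^-reduce {N} i v = fromℕ< (m%n<n i N) , (begin
  σ^ i v                              ≡⟨ cong (λ e → σ^ e v) (m≡m%n+[m/n]*n i N) ⟩
  σ^ (i % N + (i / N) * N) v          ≡⟨ σ^-+ (i % N) ((i / N) * N) v ⟩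
  σ^ (i % N) (σ^ ((i / N) * N) v)     ≡⟨ cong (σ^ (i % N)) (σ^-multiple (divides (i / N) refl) v) ⟩
  σ^ (i % N) v                        ≡⟨ cong (λ e → σ^ e v) (sym (FP.toℕ-fromℕ< (m%n<n i N))) ⟩
  σ^ (toℕ (fromℕ< (m%n<n i N))) v     ∎)
  where open ≡-Reasoning

Equivariant : ∀ {m p} → (𝔽₂^ m → 𝔽₂^ p) → Set
Equivariant f = ∀ x → f (σ x) ≡ σ (f x)

equivariant-σ^ : ∀ {m p} {f : 𝔽₂^ m → 𝔽₂^ p} → Equivariant f → ∀ k x → f (σ^ k x) ≡ σ^ k (f x)
equivariant-σ^ f-σ zero    x = refl
equivariant-σ^ f-σ (suc k) x = trans (f-σ (σ^ k x)) (cong σ (equivariant-σ^ f-σ k x))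

-- The image of a cyclically covering subspace under an equivariant map with a section is
-- cyclically covering: y = f (s y) and s y is a shift of a member of W.
image-covering : ∀ {m p} .{{_ : NonZero p}} (f : 𝔽₂^ m → 𝔽₂^ p) (lin : IsLinear f) → Equivariant f →
                 (s : 𝔽₂^ p → 𝔽₂^ m) → (∀ y → f (s y) ≡ y) →
                 {W : Subspace m} → CyclicallyCovering W → CyclicallyCovering (image f lin W)
image-covering f _ f-σ s f∘s≡id W-covering y
  with W-covering (s y)
... | i , u , u∈W , sy≡σⁱu with σ^-reduce (toℕ i) (f u)
...   | r , σⁱfu≡σʳfu = r , f u , (u , u∈W , refl) , (begin
  y                   ≡⟨ sym (f∘s≡id y) ⟩
  f (s y)             ≡⟨ cong f sy≡σⁱu ⟩
  f (σ^ (toℕ i) u)    ≡⟨ equivariant-σ^ f-σ (toℕ i) u ⟩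
  σ^ (toℕ i) (f u)    ≡⟨ σⁱfu≡σʳfu ⟩
  σ^ (toℕ r) (f u)    ∎)
  where open ≡-Reasoning

-- The preimage of a cyclically covering subspace of 𝔽₂ᵐ under an equivariant map from 𝔽₂ⁿ,
-- n ∣ m, is cyclically covering: if g x = σⁱ u, then x = σⁱ x′ with g x′ = σ^{m-i} σⁱ u = u.
preimage-covering : ∀ {n m} .{{_ : NonZero n}} → n ∣ m →
                    (g : 𝔽₂^ n → 𝔽₂^ m) (lin : IsLinear g) → Equivariant g →
                    {W : Subspace m} → CyclicallyCovering W → CyclicallyCovering (preimage g lin W)
preimage-covering {m = m} n∣m g _ g-σ {W} W-covering x
  with W-covering (g x)
... | i , u , u∈W , gx≡σⁱu with σ^-reduce (toℕ i) (σ^ (m ∸ toℕ i) x)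
...   | r , σⁱx′≡σʳx′ = r , x′ , subst (_∈ W) (sym gx′≡u) u∈W , (begin
  x                   ≡⟨ sym (σ^-multiple n∣m x) ⟩
  σ^ m x              ≡⟨ cong (λ e → σ^ e x) (sym (NP.m+[n∸m]≡n i≤m)) ⟩
  σ^ (toℕ i + t) x    ≡⟨ σ^-+ (toℕ i) t x ⟩
  σ^ (toℕ i) x′       ≡⟨ σⁱx′≡σʳx′ ⟩
  σ^ (toℕ r) x′       ∎)
  where
  open ≡-Reasoning
  i≤m : toℕ i ≤ m
  i≤m = NP.<⇒≤ (FP.toℕ<n i)
  t = m ∸ toℕ i
  x′ = σ^ t x
  gx′≡u : g x′ ≡ u
  gx′≡u = begin
    g (σ^ t x)               ≡⟨ equivariant-σ^ g-σ t x ⟩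
    σ^ t (g x)               ≡⟨ cong (σ^ t) gx≡σⁱu ⟩
    σ^ t (σ^ (toℕ i) u)      ≡⟨ sym (σ^-+ t (toℕ i) u) ⟩
    σ^ (t + toℕ i) u         ≡⟨ cong (λ e → σ^ e u) (NP.m∸n+n≡m i≤m) ⟩
    σ^ m u                   ≡⟨ σ^-period u ⟩
    u                        ∎

σ-linear : ∀ {N} → IsLinear (σ {N})
σ-linear []      []      = refl
σ-linear (a ∷ x) (b ∷ y) = cong₂ _∷_ (last-⊕ (a ∷ x) (b ∷ y)) (init-⊕ (a ∷ x) (b ∷ y))
  where
  last-⊕ : ∀ {N} (x y : 𝔽₂^ (suc N)) → last (x ⊕ y) ≡ last x xor last y
  last-⊕ (a ∷ [])     (b ∷ [])     = refl
  last-⊕ (a ∷ a′ ∷ x) (b ∷ b′ ∷ y) = last-⊕ (a′ ∷ x) (b′ ∷ y)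
  init-⊕ : ∀ {N} (x y : 𝔽₂^ (suc N)) → init (x ⊕ y) ≡ init x ⊕ init y
  init-⊕ (a ∷ [])     (b ∷ [])     = refl
  init-⊕ (a ∷ a′ ∷ x) (b ∷ b′ ∷ y) = cong ((a xor b) ∷_) (init-⊕ (a′ ∷ x) (b′ ∷ y))

σ-nonempty : ∀ {N} (x : 𝔽₂^ (suc N)) → σ x ≡ last x ∷ init x
σ-nonempty (a ∷ x) = refl

σ-++ : ∀ {n m} (x : 𝔽₂^ (suc n)) (y : 𝔽₂^ (suc m)) → σ (x ++ y) ≡ (last y ∷ init x) ++ (last x ∷ init y)
σ-++ (a ∷ x) y = cong₂ _∷_ (last-++ (a ∷ x) y) (init-++ (a ∷ x) y)
  where
  last-++ : ∀ {n m} (x : 𝔽₂^ (suc n)) (y : 𝔽₂^ (suc m)) → last (x ++ y) ≡ last y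
  last-++         (a ∷ [])     (b ∷ y) = refl
  last-++ {suc n} (a ∷ a′ ∷ x) y       = last-++ {n} (a′ ∷ x) y
  init-++ : ∀ {n m} (x : 𝔽₂^ (suc n)) (y : 𝔽₂^ (suc m)) → init (x ++ y) ≡ init x ++ (last x ∷ init y)
  init-++ (a ∷ [])     (b ∷ y) = refl
  init-++ (a ∷ a′ ∷ x) y       = cong (a ∷_) (init-++ (a′ ∷ x) y)

double : ∀ {n} → 𝔽₂^ n → 𝔽₂^ (n + n)
double x = x ++ x

fold : ∀ {n} → 𝔽₂^ (n + n) → 𝔽₂^ n
fold {n} v = take n v ⊕ drop n v

double-linear : ∀ {n} → IsLinear (double {n})
double-linear x y = sym (VP.zipWith-++ _xor_ x x y y)

double-injective : ∀ {n} (x : 𝔽₂^ n) → double x ≡ 0v → x ≡ 0v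
double-injective {n} x xx≡0 = VP.++-injectiveˡ x 0v (trans xx≡0 (sym (replicate-++ n n false)))

double-equivariant : ∀ {n} → Equivariant (double {n})
double-equivariant []      = refl
double-equivariant (a ∷ x) = sym (σ-++ (a ∷ x) (a ∷ x))

fold-++ : ∀ {n} (x y : 𝔽₂^ n) → fold (x ++ y) ≡ x ⊕ y
fold-++ {n} x y = cong₂ _⊕_ (VP.++-injectiveˡ (take n (x ++ y)) x (VP.take++drop≡id n (x ++ y)))
                            (VP.++-injectiveʳ (take n (x ++ y)) x (VP.take++drop≡id n (x ++ y)))

fold-linear : ∀ {n} → IsLinear (fold {n})
fold-linear {n} v w = begin
  take n (v ⊕ w) ⊕ drop n (v ⊕ w)
    ≡⟨ cong₂ _⊕_ (VP.take-zipWith _xor_ v w) (VP.drop-zipWith _xor_ v w) ⟩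
  (take n v ⊕ take n w) ⊕ (drop n v ⊕ drop n w)
    ≡⟨ ⊕-interchange (take n v) (take n w) (drop n v) (drop n w) ⟩
  (take n v ⊕ drop n v) ⊕ (take n w ⊕ drop n w) ∎
  where open ≡-Reasoning

fold∘double : ∀ {n} (x : 𝔽₂^ n) → fold (double x) ≡ 0v
fold∘double x = trans (fold-++ x x) (⊕-self x)

fold-section : ∀ {n} (y : 𝔽₂^ n) → fold (y ++ 0v) ≡ y
fold-section y = trans (fold-++ y 0v) (⊕-identityʳ y)

fold-equivariant : ∀ {n} → Equivariant (fold {n})
fold-equivariant {zero}  [] = refl
fold-equivariant {suc n} v  = begin
  fold (σ v)                                    ≡⟨ cong (fold ∘ σ) (sym v≡xy) ⟩
  fold (σ (x ++ y))                             ≡⟨ cong fold (σ-++ x y) ⟩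
  fold ((last y ∷ init x) ++ (last x ∷ init y)) ≡⟨ fold-++ (last y ∷ init x) (last x ∷ init y) ⟩
  (last y ∷ init x) ⊕ (last x ∷ init y)         ≡⟨ cong (_∷ (init x ⊕ init y)) (BP.xor-comm (last y) (last x)) ⟩
  (last x ∷ init x) ⊕ (last y ∷ init y)         ≡⟨ sym (cong₂ _⊕_ (σ-nonempty x) (σ-nonempty y)) ⟩
  σ x ⊕ σ y                                     ≡⟨ sym (σ-linear x y) ⟩
  σ (x ⊕ y)                                     ≡⟨ cong σ (sym (fold-++ x y)) ⟩
  σ (fold (x ++ y))                             ≡⟨ cong (σ ∘ fold) v≡xy ⟩
  σ (fold v)                                    ∎
  where
  open ≡-Reasoning
  x = take (suc n) v
  y = drop (suc n) v
  v≡xy : x ++ y ≡ v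
  v≡xy = VP.take++drop≡id (suc n) v

dim≤ : ∀ {n d} (V : Subspace n) → HasDim V d → d ≤ n
dim≤ V (b , _ , b-independent , _) = independent≤ambient b b-independent

codim-of-dim : ∀ {n d} (V : Subspace n) → HasDim V d → HasCodim V (n ∸ d)
codim-of-dim V V-dim = _ , V-dim , NP.m+[n∸m]≡n (dim≤ V V-dim)

lower : ∀ {n} → Subspace (n + n) → Subspace n
lower U = preimage double double-linear U

upper : ∀ {n} → Subspace (n + n) → Subspace n
upper U = image fold fold-linear U

lower-covering : ∀ {n} .{{_ : NonZero n}} (U : Subspace (n + n)) → CyclicallyCovering U → CyclicallyCovering (lower U)
lower-covering {n} U = preimage-covering (divides 2 (cong (n +_) (sym (NP.+-identityʳ n))))
                                         (double {n}) double-linear double-equivariant {W = U}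

upper-covering : ∀ {n} .{{_ : NonZero n}} (U : Subspace (n + n)) → CyclicallyCovering U → CyclicallyCovering (upper U)
upper-covering {n} U = image-covering (fold {n}) fold-linear fold-equivariant (_++ 0v) fold-section {W = U}

-- dim lower + dim upper ≤ dim U: doubling a basis of the lower half gives an independent
-- family in U ∩ ker fold, to which kernel+image≤dim applies.
halves-dim : ∀ {n d d₁ d₂} (U : Subspace (n + n)) {b : Vec (𝔽₂^ (n + n)) d} → IsBasis U b →
             HasDim (lower U) d₁ → HasDim (upper U) d₂ → d₁ + d₂ ≤ d
halves-dim {n} U U-basis (a₁ , a₁∈lower , a₁-indep , _) (a₂ , a₂∈upper , a₂-indep , _) =
  kernel+image≤dim (fold-linear {n}) {W = U} U-basis
    (map double a₁) doubled-indep
    (λ i → subst (_∈ U) (sym (VP.lookup-map i double a₁)) (a₁∈lower i))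
    (λ i → trans (cong fold (VP.lookup-map i double a₁)) (fold∘double (lookup a₁ i)))
    a₂ a₂-indep a₂∈upper
  where
  doubled-indep : Independent (map double a₁)
  doubled-indep α α≡0 = a₁-indep α (double-injective _ (trans
    (linear-lincomb double-linear a₁ (map double a₁) (λ i → sym (VP.lookup-map i double a₁)) α) α≡0))

codim-sum : ∀ {n d k d₁ d₂} → d + k ≡ n + n → d₁ ≤ n → d₂ ≤ n → d₁ + d₂ ≤ d → k ≤ (n ∸ d₁) + (n ∸ d₂)
codim-sum {n} {d} {k} {d₁} {d₂} d+k≡2n d₁≤n d₂≤n d₁+d₂≤d = NP.+-cancelˡ-≤ (d₁ + d₂) k (j₁ + j₂) (begin
  (d₁ + d₂) + k                ≤⟨ NP.+-monoˡ-≤ k d₁+d₂≤d ⟩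
  d + k                        ≡⟨ d+k≡2n ⟩
  n + n                        ≡⟨ sym (cong₂ _+_ (NP.m+[n∸m]≡n d₁≤n) (NP.m+[n∸m]≡n d₂≤n)) ⟩
  (d₁ + j₁) + (d₂ + j₂)        ≡⟨ +-interchange d₁ j₁ d₂ j₂ ⟩
  (d₁ + d₂) + (j₁ + j₂)        ∎)
  where
  open NP.≤-Reasoning
  j₁ = n ∸ d₁
  j₂ = n ∸ d₂

twice : ∀ j → j + j ≡ 2 * j
twice j = cong (j +_) (sym (NP.+-identityʳ j))

larger-half : ∀ {k} j₁ j₂ → k ≤ j₁ + j₂ → k ≤ 2 * j₁ ⊎ k ≤ 2 * j₂
larger-half j₁ j₂ k≤j₁+j₂ with NP.≤-total j₁ j₂
... | inj₁ j₁≤j₂ = inj₂ (NP.≤-trans k≤j₁+j₂ (subst (j₁ + j₂ ≤_) (twice j₂) (NP.+-monoˡ-≤ j₂ j₁≤j₂)))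
... | inj₂ j₂≤j₁ = inj₁ (NP.≤-trans k≤j₁+j₂ (subst (j₁ + j₂ ≤_) (twice j₁) (NP.+-monoʳ-≤ j₁ j₂≤j₁)))

halving : ∀ {n m} .{{_ : NonZero n}} → m ≡ n + n → ∀ k (U : Subspace m) → CyclicallyCovering U → HasCodim U k →
          ∃ λ j → ∃ λ (V : Subspace n) → CyclicallyCovering V × HasCodim V j × k ≤ 2 * j
halving {n} refl k U U-covering (d , (_ , U-basis) , d+k≡2n) =
  [ (λ k≤2j₁ → _ , lower U , lower-covering U U-covering , codim-of-dim (lower U) lower-dim , k≤2j₁)
  , (λ k≤2j₂ → _ , upper U , upper-covering U U-covering , codim-of-dim (upper U) upper-dim , k≤2j₂)
  ]′ (larger-half (n ∸ proj₁ lower-basis) (n ∸ proj₁ upper-basis)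
        (codim-sum d+k≡2n (dim≤ (lower U) lower-dim) (dim≤ (upper U) upper-dim)
                          (halves-dim U U-basis lower-dim upper-dim)))
  where
  U? : ∀ u → Dec (u ∈ U)
  U? = basis-decidable {W = U} U-basis
  lower-basis : ∃ (HasDim (lower U))
  lower-basis = BasisExtension.basis (lower U) (U? ∘ double)
  upper-basis : ∃ (HasDim (upper U))
  upper-basis = BasisExtension.basis (upper U) (image-decidable (fold {n}) fold-linear {W = U} U?)
  lower-dim : HasDim (lower U) (proj₁ lower-basis)
  lower-dim = proj₂ lower-basis
  upper-dim : HasDim (upper U) (proj₁ upper-basis)
  upper-dim = proj₂ upper-basis

-- The theorem: 2 * n is n + (n + 0), and 1 ≤ n makes n nonzero.
theorem2p3 : ∀ (n : ℕ) → 1 ≤ n → ∀ (k : ℕ) (U : Subspace (2 * n)) → CyclicallyCovering U → HasCodim U k → ∃ λ (j : ℕ) → ∃ λ (V : Subspace n) → CyclicallyCovering V × HasCodim V j × (k ≤ 2 * j)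
theorem2p3 n@(suc _) _ = halving {n} (cong (n +_) (NP.+-identityʳ n))
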